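{- Let $\mathcal{C}$ be a distributive category (a category with finite products and finite coproducts in which, for all objects $A,B,C$, the canonical morphism $A\times B + A\times C\to A\times (B+C)$ is an isomorphism), and let $S$ be an object of $\mathcal{C}$ (the object of states). Consider the language for states whose pure terms $A\to B$ are the morphisms $A\to B$ of $\mathcal{C}$ and whose general terms (modifiers) $A\to B$ are the morphisms $A\times S\to B\times S$ of $\mathcal{C}$, as described in the context. Then this language is compatible with conditionals, and it is compatible with sequential pairs with respect to the weak equality $\sim$. Explicitly: (1) (Conditionals) for all modifiers $f_1\colon A_1\to B$ and $f_2\colon A_2\to B$ (i.e. morphisms $f_1\colon A_1\times S\to B\times S$, $f_2\colon A_2\times S\to B\times S$ in $\mathcal{C}$) there exists a unique modifier $h\colon A_1+A_2\to B$ (a morphism $h\colon (A_1+A_2)\times S\to B\times S$) with $h\circ(\mathrm{copr}_1\times \mathrm{id}_S)=f_1$ and $h\circ(\mathrm{copr}_2\times\mathrm{id}_S)=f_2$; (2) (Sequential pairs) for every pure term $f_1\colon A\to B_1$ and every modifier $f_2\colon A\to B_2$ there exists a unique modifier $\langle f_1,f_2\rangle_l\colon A\to B_1\times B_2$ such that $\mathrm{pr}_1\circ\langle f_1,f_2\rangle_l\sim f_1$ and $\mathrm{pr}_2\circ\langle f_1,f_2\rangle_l= f_2$ (composition and equalities taken in the category of modifiers), and symmetrically for every modifier $f_1\colon A\to B_1$ and pure term $f_2\colon A\to B_2$ there exists a unique modifier $\langle f_1,f_2\rangle_r\colon A\to B_1\times B_2$ with $\mathrm{pr}_1\circ\langle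 f_1,f_2\rangle_r= f_1$ and $\mathrm{pr}_2\circ\langle f_1,f_2\rangle_r\sim f_2$.
   Context: The comonad of states on $\mathcal{C}$ has endofunctor $X\mapsto X\times S$, counit $\varepsilon_X\colon X\times S\to X$ the projection. Terms of the language for states are interpreted as follows: a pure term $f\colon A\to B$ is a morphism $f\colon A\to B$ of $\mathcal{C}$; a modifier (general term) $h\colon A\to B$ is a morphism $h\colon A\times S\to B\times S$ of $\mathcal{C}$; modifiers compose as morphisms of $\mathcal{C}$, and a pure term $f$ is regarded as the modifier $f\times\mathrm{id}_S$. In particular the structural morphisms (projections $\mathrm{pr}_i\colon B_1\times B_2\to B_i$, coprojections $\mathrm{copr}_i\colon A_i\to A_1+A_2$) are pure. A (strong) equation $f=g$ between modifiers $A\to B$ means equality of the morphisms $A\times S\to B\times S$; a weak equation $f\sim g$ between modifiers $A\to B$ means $\varepsilon_B\circ f=\varepsilon_B\circ g\colon A\times S\to B$. A language with effects (pure terms forming a category $\mathcal{C}$ with finite products and coproducts, general terms forming a larger category with the same objects) is compatible with conditionals if copairs of general terms exist uniquely as in (1), and compatible with sequential pairs with respect to a relation $\gg$ between pure and general terms (equal to equality on pure terms) if left and right pairs of a pure term and a general term exist uniquely as in (2), with $\sim$ here playing the role of $\gg$. -}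

module Defs where

open import Level using (Level; suc; _⊔_)
open import Data.Product using (Σ; _×_; _,_)
open import Relation.Binary using (IsEquivalence)

-- A category whose hom-sets carry an equivalence relation _≈_ (setoid-enriched,
-- the standard constructive rendering of equality of morphisms).
record Category (o m e : Level) : Set (suc (o ⊔ m ⊔ e)) where
  infixr 9 _∘_
  infix 4 _≈_
  field
    Obj   : Set o
    Hom   : Obj → Obj → Set m
    _≈_   : ∀ {A B} → Hom A B → Hom A B → Set e
    id    : ∀ {A} → Hom A A
    _∘_   : ∀ {A B C} → Hom B C → Hom A B → Hom A C
    ≈-equiv : ∀ {A B} → IsEquivalence (_≈_ {A} {B})
    ∘-resp-≈ : ∀ {A B C} {f f' : Hom B C} {g g' : Hom A B} →
               f ≈ f' → g ≈ g' → f ∘ g ≈ f' ∘ g'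
    assoc : ∀ {A B C D} (f : Hom C D) (g : Hom B C) (h : Hom A B) →
            (f ∘ g) ∘ h ≈ f ∘ (g ∘ h)
    identityˡ : ∀ {A B} (f : Hom A B) → id ∘ f ≈ f
    identityʳ : ∀ {A B} (f : Hom A B) → f ∘ id ≈ f

∃!≈ : ∀ {o m e ℓ} (C : Category o m e) {A B : Category.Obj C} →
      (Category.Hom C A B → Set ℓ) → Set (m ⊔ e ⊔ ℓ)
∃!≈ C {A} {B} P = Σ (Hom A B) λ h → P h × (∀ h' → P h' → h' ≈ h)
  where open Category C

record DistributiveCategory (o m e : Level) : Set (suc (o ⊔ m ⊔ e)) where
  field
    cat : Category o m e
  open Category cat public
  infixr 7 _⊗_
  infixr 6 _⊕_
  field
    ⊤ : Obj
    ! : ∀ {A} → Hom A ⊤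
    !-unique : ∀ {A} (f : Hom A ⊤) → f ≈ !
    _⊗_ : Obj → Obj → Obj
    pr₁ : ∀ {A B} → Hom (A ⊗ B) A
    pr₂ : ∀ {A B} → Hom (A ⊗ B) B
    ⟨_,_⟩ : ∀ {X A B} → Hom X A → Hom X B → Hom X (A ⊗ B)
    pr₁-⟨⟩ : ∀ {X A B} (f : Hom X A) (g : Hom X B) → pr₁ ∘ ⟨ f , g ⟩ ≈ f
    pr₂-⟨⟩ : ∀ {X A B} (f : Hom X A) (g : Hom X B) → pr₂ ∘ ⟨ f , g ⟩ ≈ g
    ⟨⟩-unique : ∀ {X A B} (f : Hom X A) (g : Hom X B) (h : Hom X (A ⊗ B)) →
                pr₁ ∘ h ≈ f → pr₂ ∘ h ≈ g → h ≈ ⟨ f , g ⟩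
    ⊥ : Obj
    ¡ : ∀ {A} → Hom ⊥ A
    ¡-unique : ∀ {A} (f : Hom ⊥ A) → f ≈ ¡
    _⊕_ : Obj → Obj → Obj
    copr₁ : ∀ {A B} → Hom A (A ⊕ B)
    copr₂ : ∀ {A B} → Hom B (A ⊕ B)
    [_,_] : ∀ {A B X} → Hom A X → Hom B X → Hom (A ⊕ B) X
    []-copr₁ : ∀ {A B X} (f : Hom A X) (g : Hom B X) → [ f , g ] ∘ copr₁ ≈ f
    []-copr₂ : ∀ {A B X} (f : Hom A X) (g : Hom B X) → [ f , g ] ∘ copr₂ ≈ g
    []-unique : ∀ {A B X} (f : Hom A X) (g : Hom B X) (h : Hom (A ⊕ B) X) →
                h ∘ copr₁ ≈ f → h ∘ copr₂ ≈ g → h ≈ [ f , g ]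

  _⊗₁_ : ∀ {A B C D} → Hom A C → Hom B D → Hom (A ⊗ B) (C ⊗ D)
  f ⊗₁ g = ⟨ f ∘ pr₁ , g ∘ pr₂ ⟩

  distrib : ∀ {A B C} → Hom ((A ⊗ B) ⊕ (A ⊗ C)) (A ⊗ (B ⊕ C))
  distrib = [ id ⊗₁ copr₁ , id ⊗₁ copr₂ ]

  field
    distrib⁻¹ : ∀ {A B C} → Hom (A ⊗ (B ⊕ C)) ((A ⊗ B) ⊕ (A ⊗ C))
    distrib-isoˡ : ∀ {A B C} → distrib⁻¹ {A} {B} {C} ∘ distrib ≈ id
    distrib-isoʳ : ∀ {A B C} → distrib {A} {B} {C} ∘ distrib⁻¹ ≈ id

module States {o m e} (D : DistributiveCategory o m e) (S : DistributiveCategory.Obj D) where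
  open DistributiveCategory D

  infixr 9 _∘M_
  infix 4 _≈M_ _∼_

  Mod : Obj → Obj → Set m
  Mod A B = Hom (A ⊗ S) (B ⊗ S)

  _≈M_ : ∀ {A B} → Mod A B → Mod A B → Set e
  f ≈M g = f ≈ g

  _∘M_ : ∀ {A B C} → Mod B C → Mod A B → Mod A C
  g ∘M f = g ∘ f

  pure : ∀ {A B} → Hom A B → Mod A B
  pure f = f ⊗₁ id

  ε : ∀ {X} → Hom (X ⊗ S) X
  ε = pr₁

  _∼_ : ∀ {A B} → Mod A B → Mod A B → Set e
  f ∼ g = ε ∘ f ≈ ε ∘ g

module Submission where

-- Every part of the theorem is an instance of one pattern: the defining
-- conditions of the wanted modifier are logically equivalent (`⇔`) to the
-- conditions of a universal property we already know, and unique existence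
-- transfers along such an equivalence (`∃!≈-⇔`).
--
--  * Conditionals.  Modifiers out of A₁ + A₂ are morphisms out of
--    (A₁ + A₂) × S, which is a coproduct of S × A₁ and S × A₂ through the
--    isomorphism  swap ∘ distrib  (`coproduct-along-iso`).  Precomposing
--    with the isomorphism swap turns the conditions  h ∘ (copr_i × id) ≈ f_i
--    into the copairing conditions for this coproduct (`pure-copr-⇔`).
--  * Sequential pairs.  A modifier A → B₁ × B₂ is a morphism into the triple
--    product (B₁ × B₂) × S, determined by its three components (`∃!-triple`).
--    A strong equation  pure p ∘ l ≈ g  fixes two components, a weak one
--    pure p ∘ l ∼ pure f  fixes only the first (`strong-pure-⇔`,
--    `weak-pure-⇔`); together they fix all three.

open import Level using (Level; _⊔_)
open import Data.Product using (_×_; _,_)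
open import Data.Product.Function.NonDependent.Propositional using (_×-⇔_)
open import Function.Bundles using (_⇔_; mk⇔; module Equivalence)
open import Function.Construct.Composition using (_⇔-∘_)
open import Relation.Binary using (IsEquivalence; Setoid)
import Relation.Binary.Reasoning.Setoid as SetoidReasoning
open import Defs

module CategoryFacts {o m e : Level} (C : Category o m e) where
  open Category C

  hom-setoid : Obj → Obj → Setoid m e
  hom-setoid A B = record { Carrier = Hom A B ; _≈_ = _≈_ ; isEquivalence = ≈-equiv }

  module _ {A B : Obj} where
    open IsEquivalence (≈-equiv {A} {B}) public
      renaming (refl to ≈-refl; sym to ≈-sym; trans to ≈-trans)
    open SetoidReasoning (hom-setoid A B) public

  ∘-congˡ : ∀ {A B C} {f f' : Hom B C} {g : Hom A B} → f ≈ f' → f ∘ g ≈ f' ∘ g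
  ∘-congˡ p = ∘-resp-≈ p ≈-refl

  ∘-congʳ : ∀ {A B C} {f : Hom B C} {g g' : Hom A B} → g ≈ g' → f ∘ g ≈ f ∘ g'
  ∘-congʳ p = ∘-resp-≈ ≈-refl p

  pullˡ : ∀ {A B C D} {g : Hom C D} {h : Hom B C} {k : Hom B D} {x : Hom A B} →
          g ∘ h ≈ k → g ∘ h ∘ x ≈ k ∘ x
  pullˡ p = ≈-trans (≈-sym (assoc _ _ _)) (∘-congˡ p)

  extendʳ : ∀ {A B B' C D} {g : Hom C D} {h : Hom B C} {k : Hom B' D} {j : Hom B B'}
            {x : Hom A B} → g ∘ h ≈ k ∘ j → g ∘ h ∘ x ≈ k ∘ j ∘ x
  extendʳ p = ≈-trans (pullˡ p) (assoc _ _ _)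

  ≈-⇔-resp : ∀ {A B} {a a' b b' : Hom A B} → a ≈ a' → b ≈ b' → (a ≈ b) ⇔ (a' ≈ b')
  ≈-⇔-resp p q =
    mk⇔ (λ r → ≈-trans (≈-sym p) (≈-trans r q)) (λ r → ≈-trans p (≈-trans r (≈-sym q)))

  ∃!≈-⇔ : ∀ {ℓ ℓ'} {A B} {P : Hom A B → Set ℓ} {Q : Hom A B → Set ℓ'} →
          (∀ h → P h ⇔ Q h) → ∃!≈ C Q → ∃!≈ C P
  ∃!≈-⇔ P⇔Q (h , Qh , unique) =
    h , Equivalence.from (P⇔Q h) Qh , λ h' Ph' → unique h' (Equivalence.to (P⇔Q h') Ph')

  record IsIso {A B} (f : Hom A B) : Set (m ⊔ e) where
    field
      inv  : Hom B A
      isoˡ : inv ∘ f ≈ id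
      isoʳ : f ∘ inv ≈ id

  ∘-isIso : ∀ {A B C} {f : Hom A B} {g : Hom B C} → IsIso f → IsIso g → IsIso (g ∘ f)
  ∘-isIso {f = f} {g} F G = record
    { inv  = F.inv ∘ G.inv
    ; isoˡ = begin
        (F.inv ∘ G.inv) ∘ g ∘ f   ≈⟨ assoc _ _ _ ⟩
        F.inv ∘ G.inv ∘ g ∘ f     ≈⟨ ∘-congʳ (pullˡ G.isoˡ) ⟩
        F.inv ∘ id ∘ f            ≈⟨ ∘-congʳ (identityˡ f) ⟩
        F.inv ∘ f                 ≈⟨ F.isoˡ ⟩
        id                        ∎
    ; isoʳ = begin
        (g ∘ f) ∘ F.inv ∘ G.inv   ≈⟨ assoc _ _ _ ⟩
        g ∘ f ∘ F.inv ∘ G.inv     ≈⟨ ∘-congʳ (pullˡ F.isoʳ) ⟩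
        g ∘ id ∘ G.inv            ≈⟨ ∘-congʳ (identityˡ G.inv) ⟩
        g ∘ G.inv                 ≈⟨ G.isoʳ ⟩
        id                        ∎
    }
    where
    module F = IsIso F
    module G = IsIso G

  iso-move : ∀ {A B C} {φ : Hom A B} {g : Hom B C} {k : Hom A C} →
             (Φ : IsIso φ) → g ∘ φ ≈ k → g ≈ k ∘ IsIso.inv Φ
  iso-move {φ = φ} {g} {k} Φ p = begin
    g                 ≈⟨ ≈-sym (identityʳ g) ⟩
    g ∘ id            ≈⟨ ∘-congʳ (≈-sym (IsIso.isoʳ Φ)) ⟩
    g ∘ φ ∘ inv       ≈⟨ pullˡ p ⟩
    k ∘ inv           ∎
    where open IsIso Φ

  precompose-iso-⇔ : ∀ {A B C} {σ : Hom A B} {g f : Hom B C} →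
                     IsIso σ → (g ≈ f) ⇔ (g ∘ σ ≈ f ∘ σ)
  precompose-iso-⇔ {σ = σ} {g} {f} Σ = mk⇔ ∘-congˡ cancel
    where
    open IsIso Σ
    cancel : g ∘ σ ≈ f ∘ σ → g ≈ f
    cancel p = begin
      g                 ≈⟨ iso-move Σ p ⟩
      (f ∘ σ) ∘ inv     ≈⟨ assoc _ _ _ ⟩
      f ∘ σ ∘ inv       ≈⟨ ∘-congʳ isoʳ ⟩
      f ∘ id            ≈⟨ identityʳ f ⟩
      f                 ∎

module DistributiveFacts {o m e : Level} (D : DistributiveCategory o m e) where
  open DistributiveCategory D
  open CategoryFacts cat public

  pr-jointly-monic : ∀ {X A B} {g h : Hom X (A ⊗ B)} →
                     pr₁ ∘ g ≈ pr₁ ∘ h → pr₂ ∘ g ≈ pr₂ ∘ h → g ≈ h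
  pr-jointly-monic {h = h} p q =
    ≈-trans (⟨⟩-unique _ _ _ p q) (≈-sym (⟨⟩-unique _ _ h ≈-refl ≈-refl))

  ∃!-triple : ∀ {X A B C} (a : Hom X A) (b : Hom X B) (c : Hom X C) →
              ∃!≈ cat (λ t → (pr₁ ∘ pr₁ ∘ t ≈ a) × (pr₂ ∘ pr₁ ∘ t ≈ b) × (pr₂ ∘ t ≈ c))
  ∃!-triple a b c =
    ⟨ ⟨ a , b ⟩ , c ⟩ ,
    (≈-trans (∘-congʳ (pr₁-⟨⟩ _ _)) (pr₁-⟨⟩ _ _) ,
     ≈-trans (∘-congʳ (pr₁-⟨⟩ _ _)) (pr₂-⟨⟩ _ _) ,
     pr₂-⟨⟩ _ _) ,
    λ t (p , q , r) → ⟨⟩-unique _ _ t (⟨⟩-unique _ _ _ p q) r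

  swap : ∀ {A B} → Hom (A ⊗ B) (B ⊗ A)
  swap = ⟨ pr₂ , pr₁ ⟩

  swap-involutive : ∀ {A B} → swap {B} {A} ∘ swap {A} {B} ≈ id
  swap-involutive = pr-jointly-monic
    (≈-trans (pullˡ (pr₁-⟨⟩ _ _)) (≈-trans (pr₂-⟨⟩ _ _) (≈-sym (identityʳ pr₁))))
    (≈-trans (pullˡ (pr₂-⟨⟩ _ _)) (≈-trans (pr₁-⟨⟩ _ _) (≈-sym (identityʳ pr₂))))

  swap-isIso : ∀ {A B} → IsIso (swap {A} {B})
  swap-isIso = record { inv = swap ; isoˡ = swap-involutive ; isoʳ = swap-involutive }

  swap-natural : ∀ {A B C D'} (p : Hom A C) (q : Hom B D') →
                 swap ∘ (p ⊗₁ q) ≈ (q ⊗₁ p) ∘ swap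
  swap-natural p q = pr-jointly-monic
    (begin
      pr₁ ∘ swap ∘ (p ⊗₁ q)     ≈⟨ pullˡ (pr₁-⟨⟩ _ _) ⟩
      pr₂ ∘ (p ⊗₁ q)            ≈⟨ pr₂-⟨⟩ _ _ ⟩
      q ∘ pr₂                   ≈⟨ ∘-congʳ (≈-sym (pr₁-⟨⟩ _ _)) ⟩
      q ∘ pr₁ ∘ swap            ≈⟨ ≈-sym (extendʳ (pr₁-⟨⟩ _ _)) ⟩
      pr₁ ∘ (q ⊗₁ p) ∘ swap     ∎)
    (begin
      pr₂ ∘ swap ∘ (p ⊗₁ q)     ≈⟨ pullˡ (pr₂-⟨⟩ _ _) ⟩
      pr₁ ∘ (p ⊗₁ q)            ≈⟨ pr₁-⟨⟩ _ _ ⟩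
      p ∘ pr₁                   ≈⟨ ∘-congʳ (≈-sym (pr₂-⟨⟩ _ _)) ⟩
      p ∘ pr₂ ∘ swap            ≈⟨ ≈-sym (extendʳ (pr₂-⟨⟩ _ _)) ⟩
      pr₂ ∘ (q ⊗₁ p) ∘ swap     ∎)

  distrib-isIso : ∀ {A B C} → IsIso (distrib {A} {B} {C})
  distrib-isIso = record { inv = distrib⁻¹ ; isoˡ = distrib-isoˡ ; isoʳ = distrib-isoʳ }

  coproduct-along-iso : ∀ {A₁ A₂ Z X} {φ : Hom (A₁ ⊕ A₂) Z} → IsIso φ →
                        (f₁ : Hom A₁ X) (f₂ : Hom A₂ X) →
                        ∃!≈ cat (λ h → (h ∘ φ ∘ copr₁ ≈ f₁) × (h ∘ φ ∘ copr₂ ≈ f₂))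
  coproduct-along-iso {A₁} {A₂} {φ = φ} Φ f₁ f₂ =
    [ f₁ , f₂ ] ∘ inv , (injection ([]-copr₁ f₁ f₂) , injection ([]-copr₂ f₁ f₂)) ,
    λ h (p₁ , p₂) → iso-move Φ ([]-unique f₁ f₂ (h ∘ φ) (≈-trans (assoc _ _ _) p₁)
                                                       (≈-trans (assoc _ _ _) p₂))
    where
    open IsIso Φ
    injection : ∀ {A Y} {c : Hom A (A₁ ⊕ A₂)} {f : Hom A Y} {k : Hom (A₁ ⊕ A₂) Y} →
                k ∘ c ≈ f → (k ∘ inv) ∘ φ ∘ c ≈ f
    injection {c = c} {f} {k} p = begin
      (k ∘ inv) ∘ φ ∘ c   ≈⟨ assoc _ _ _ ⟩
      k ∘ inv ∘ φ ∘ c     ≈⟨ ∘-congʳ (pullˡ isoˡ) ⟩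
      k ∘ id ∘ c          ≈⟨ ∘-congʳ (identityˡ c) ⟩
      k ∘ c               ≈⟨ p ⟩
      f                   ∎

module StateFacts {o m e : Level} (D : DistributiveCategory o m e) (S : DistributiveCategory.Obj D) where
  open DistributiveCategory D
  open DistributiveFacts D
  open States D S

  ε-natural : ∀ {A B} (p : Hom A B) → ε ∘ pure p ≈ p ∘ ε
  ε-natural p = pr₁-⟨⟩ _ _

  pr₂-pure : ∀ {A B} (p : Hom A B) → pr₂ ∘ pure p ≈ pr₂
  pr₂-pure p = ≈-trans (pr₂-⟨⟩ _ _) (identityˡ pr₂)

  weak-pure-⇔ : ∀ {X A B} (p : Hom A B) (l : Mod X A) (f : Hom X B) →
                (pure p ∘M l ∼ pure f) ⇔ (p ∘ ε ∘ l ≈ f ∘ ε)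
  weak-pure-⇔ p l f = ≈-⇔-resp (extendʳ (ε-natural p)) (ε-natural f)

  strong-pure-⇔ : ∀ {X A B} (p : Hom A B) (l : Mod X A) (g : Mod X B) →
                  (pure p ∘M l ≈M g) ⇔ ((p ∘ ε ∘ l ≈ ε ∘ g) × (pr₂ ∘ l ≈ pr₂ ∘ g))
  strong-pure-⇔ p l g = mk⇔
    (λ q → ≈-trans (≈-sym (extendʳ (ε-natural p))) (∘-congʳ q) ,
           ≈-trans (≈-sym (pullˡ (pr₂-pure p))) (∘-congʳ q))
    (λ (q₁ , q₂) → pr-jointly-monic (≈-trans (extendʳ (ε-natural p)) q₁)
                                    (≈-trans (pullˡ (pr₂-pure p)) q₂))

  pure-copr-⇔ : ∀ {A A₁ A₂ B} (h : Mod (A₁ ⊕ A₂) B) {f : Mod A B}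
                {copr : Hom A (A₁ ⊕ A₂)} {d : Hom (S ⊗ A) ((S ⊗ A₁) ⊕ (S ⊗ A₂))} →
                distrib ∘ d ≈ id ⊗₁ copr →
                (h ∘M pure copr ≈M f) ⇔ (h ∘ (swap ∘ distrib) ∘ d ≈ f ∘ swap)
  pure-copr-⇔ h {f} {copr} {d} distrib-d =
    ≈-⇔-resp swapped ≈-refl ⇔-∘ precompose-iso-⇔ swap-isIso
    where
    swapped : (h ∘ pure copr) ∘ swap ≈ h ∘ (swap ∘ distrib) ∘ d
    swapped = begin
      (h ∘ pure copr) ∘ swap      ≈⟨ assoc _ _ _ ⟩
      h ∘ (copr ⊗₁ id) ∘ swap     ≈⟨ ∘-congʳ (≈-sym (swap-natural id copr)) ⟩
      h ∘ swap ∘ (id ⊗₁ copr)     ≈⟨ ∘-congʳ (∘-congʳ (≈-sym distrib-d)) ⟩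
      h ∘ swap ∘ distrib ∘ d      ≈⟨ ∘-congʳ (≈-sym (assoc _ _ _)) ⟩
      h ∘ (swap ∘ distrib) ∘ d    ∎

  -- The copair of f₁ and f₂ is  [f₁ ∘ swap, f₂ ∘ swap] ∘ (swap ∘ distrib)⁻¹.
  conditionals : ∀ {A₁ A₂ B} (f₁ : Mod A₁ B) (f₂ : Mod A₂ B) →
    ∃!≈ cat {(A₁ ⊕ A₂) ⊗ S} {B ⊗ S} (λ h →
      (h ∘M pure copr₁ ≈M f₁) × (h ∘M pure copr₂ ≈M f₂))
  conditionals f₁ f₂ =
    ∃!≈-⇔ (λ h → pure-copr-⇔ h ([]-copr₁ _ _) ×-⇔ pure-copr-⇔ h ([]-copr₂ _ _))
          (coproduct-along-iso (∘-isIso distrib-isIso swap-isIso) (f₁ ∘ swap) (f₂ ∘ swap))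

  left-pairs : ∀ {A B₁ B₂} (f₁ : Hom A B₁) (f₂ : Mod A B₂) →
    ∃!≈ cat {A ⊗ S} {(B₁ ⊗ B₂) ⊗ S} (λ l →
      (pure pr₁ ∘M l ∼ pure f₁) × (pure pr₂ ∘M l ≈M f₂))
  left-pairs f₁ f₂ =
    ∃!≈-⇔ (λ l → weak-pure-⇔ pr₁ l f₁ ×-⇔ strong-pure-⇔ pr₂ l f₂)
          (∃!-triple (f₁ ∘ ε) (ε ∘ f₂) (pr₂ ∘ f₂))

  right-pairs : ∀ {A B₁ B₂} (f₁ : Mod A B₁) (f₂ : Hom A B₂) →
    ∃!≈ cat {A ⊗ S} {(B₁ ⊗ B₂) ⊗ S} (λ r →
      (pure pr₁ ∘M r ≈M f₁) × (pure pr₂ ∘M r ∼ pure f₂))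
  right-pairs f₁ f₂ =
    ∃!≈-⇔ (λ r → reorder ⇔-∘ (strong-pure-⇔ pr₁ r f₁ ×-⇔ weak-pure-⇔ pr₂ r f₂))
          (∃!-triple (ε ∘ f₁) (f₂ ∘ ε) (pr₂ ∘ f₁))
    where
    reorder : ∀ {a b c} {P : Set a} {Q : Set b} {R : Set c} → ((P × R) × Q) ⇔ (P × Q × R)
    reorder = mk⇔ (λ ((p , r) , q) → p , q , r) (λ (p , q , r) → (p , r) , q)

theorem4p1 : ∀ {o m e : Level} (D : DistributiveCategory o m e) (S : DistributiveCategory.Obj D) →
  let open DistributiveCategory D
      open States D S
  in
  -- (1) compatibility with conditionals
  (∀ {A₁ A₂ B} (f₁ : Mod A₁ B) (f₂ : Mod A₂ B) →
    ∃!≈ cat {(A₁ ⊕ A₂) ⊗ S} {B ⊗ S} (λ h →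
      (h ∘M pure copr₁ ≈M f₁) × (h ∘M pure copr₂ ≈M f₂)))
  ×
  -- (2a) left sequential pairs
  (∀ {A B₁ B₂} (f₁ : Hom A B₁) (f₂ : Mod A B₂) →
    ∃!≈ cat {A ⊗ S} {(B₁ ⊗ B₂) ⊗ S} (λ l →
      (pure pr₁ ∘M l ∼ pure f₁) × (pure pr₂ ∘M l ≈M f₂)))
  ×
  -- (2b) right sequential pairs
  (∀ {A B₁ B₂} (f₁ : Mod A B₁) (f₂ : Hom A B₂) →
    ∃!≈ cat {A ⊗ S} {(B₁ ⊗ B₂) ⊗ S} (λ r →
      (pure pr₁ ∘M r ≈M f₁) × (pure pr₂ ∘M r ∼ pure f₂)))
theorem4p1 D S = conditionals , left-pairs , right-pairs
  where open StateFacts D S
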